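{- Let $m>1$ be an integer and let $k>1$ be an odd integer. Put $c=\binom{k}{\frac{k-1}{2}}\cdot m^k$. Then for every integer base $b\ge c$, the number $[m\cdot(b-1)]^k$ is antipalindromic in base $b$.
   Context: For $b\in\mathbb N$, $b\ge2$, write a natural number $x$ in base $b$ as $x=a_tb^t+\dots+a_1b+a_0$ with digits $a_i\in\{0,1,\dots,b-1\}$ and $a_t\neq 0$. The number $x$ is called antipalindromic in base $b$ if $a_j=b-1-a_{t-j}$ for all $j\in\{0,1,\dots,t\}$. -}

module Defs where

open import Data.Nat using (ℕ; zero; suc; _+_; _*_; _∸_; _<_)
open import Data.List using (List; []; _∷_; map; reverse; last)
open import Data.List.Relation.Unary.All using (All)
open import Data.Maybe using (just)
open import Data.Product using (∃; _×_)
open import Relation.Binary.PropositionalEquality using (_≡_; _≢_)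

evalDigits : ℕ → List ℕ → ℕ
evalDigits b []       = 0
evalDigits b (a ∷ as) = a + b * evalDigits b as

IsBaseExpansion : ℕ → List ℕ → ℕ → Set
IsBaseExpansion b ds x =
  All (_< b) ds × (∃ λ aₜ → last ds ≡ just aₜ × aₜ ≢ 0) × evalDigits b ds ≡ x

Antipalindromic : ℕ → ℕ → Set
Antipalindromic b x =
  ∃ λ ds → IsBaseExpansion b ds x × map (λ a → b ∸ 1 ∸ a) (reverse ds) ≡ ds

-- With d i = m^k · C(k,i), the binomial theorem gives, for odd k,
--   (m(b-1))^k = Σ_{i ≤ k} (-1)^(i+1) d i b^i.
-- Borrowing one unit from place i+1 at every even place i turns this signed
-- expansion into honest base-b digits: b - d i at even places and d i - 1 at
-- odd places.  The bound C(k,(k-1)/2) · m^k ≤ b keeps every d i in [1, b],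
-- and the symmetry C(k,k-i) = C(k,i) together with the opposite parities of i
-- and k - i makes the digit string antipalindromic.
module Submission where

open import Defs
open import Data.Nat using (ℕ; _*_; _∸_; _^_; _≤_; _<_; _+_)
open import Data.Nat.Combinatorics using (_C_)
open import Relation.Binary.PropositionalEquality using (_≡_)
open import Data.Nat using (zero; suc; z≤n; s≤s; _≤?_; >-nonZero; parity)
open import Data.Nat.Properties
open import Algebra.Properties.CommutativeSemigroup *-commutativeSemigroup using (x∙yz≈y∙xz; interchange)
open import Data.Nat.Combinatorics
  using (nCk+nC[k+1]≡[n+1]C[k+1]; k>n⇒nCk≡0; nCk≡nC[n∸k]; nCn≡1; nC1≡n)
open import Data.Parity.Base using (Parity; 0ℙ; 1ℙ; _⁻¹) renaming (_+_ to _+ℙ_)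
import Data.Parity.Properties as ℙ
open import Data.Integer.Base as ℤ using (ℤ; +_; 0ℤ; 1ℤ; -1ℤ)
import Data.Integer.Properties as ℤₚ
open import Data.Integer.Tactic.RingSolver using (solve-∀)
open import Algebra.Definitions.RawMonoid ℤ.+-0-rawMonoid using (_×_)
open import Algebra.Properties.Semiring.Exp ℤₚ.+-*-semiring using () renaming (_^_ to _^ᴿ_)
open import Algebra.Properties.Semiring.Sum ℤₚ.+-*-semiring
  using (sum-syntax; sum⁺-syntax; sum-cong-≗; ∑-distrib-+; *-distribˡ-sum)
import Algebra.Properties.CommutativeSemiring.Binomial ℤₚ.+-*-commutativeSemiring as Binomial
open import Data.Fin.Base using (toℕ)
open import Data.Fin.Properties using (toℕ≤pred[n])
open import Data.List.Base using (List; _∷_; map; reverse; last; applyUpTo; applyDownFrom)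
open import Data.List.Properties using (reverse-applyUpTo; map-applyUpTo)
open import Data.List.Relation.Unary.All using (All)
open import Data.List.Relation.Unary.All.Properties using (applyUpTo⁺₁)
open import Data.Maybe.Base using (just)
open import Data.Product.Base using (_,_)
open import Data.Sum.Base using (inj₁; inj₂)
open import Function.Base using (_∘_)
open import Relation.Nullary using (yes; no)
open import Relation.Binary.PropositionalEquality
  using (refl; sym; trans; cong; cong₂; subst; module ≡-Reasoning)

private variable A : Set

[k+1]*[n+1]C[k+1]≡[n+1]*nCk : ∀ n k → suc k * (suc n C suc k) ≡ suc n * (n C k)
[k+1]*[n+1]C[k+1]≡[n+1]*nCk n zero =
  trans (*-identityˡ (suc n C 1)) (trans (nC1≡n (suc n)) (sym (*-identityʳ (suc n))))
[k+1]*[n+1]C[k+1]≡[n+1]*nCk zero (suc k) = begin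
  suc (suc k) * (1 C suc (suc k)) ≡⟨ cong (suc (suc k) *_) (k>n⇒nCk≡0 {1} {suc (suc k)} (s≤s (s≤s z≤n))) ⟩
  suc (suc k) * 0                 ≡⟨ *-zeroʳ (suc (suc k)) ⟩
  0                               ≡⟨ cong (1 *_) (k>n⇒nCk≡0 {0} {suc k} (s≤s z≤n)) ⟨
  1 * (0 C suc k)                 ∎
  where open ≡-Reasoning
[k+1]*[n+1]C[k+1]≡[n+1]*nCk (suc n) (suc k) = begin
  suc (suc k) * (suc (suc n) C suc (suc k)) ≡⟨ cong (suc (suc k) *_) (nCk+nC[k+1]≡[n+1]C[k+1] (suc n) (suc k)) ⟨
  suc (suc k) * (c + c′)                     ≡⟨ *-distribˡ-+ (suc (suc k)) c c′ ⟩
  (c + suc k * c) + suc (suc k) * c′         ≡⟨ cong₂ (λ x y → (c + x) + y) ([k+1]*[n+1]C[k+1]≡[n+1]*nCk n k)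
                                                      ([k+1]*[n+1]C[k+1]≡[n+1]*nCk n (suc k)) ⟩
  (c + suc n * (n C k)) + suc n * (n C suc k) ≡⟨ +-assoc c _ _ ⟩
  c + (suc n * (n C k) + suc n * (n C suc k)) ≡⟨ cong (_+_ c) (*-distribˡ-+ (suc n) (n C k) (n C suc k)) ⟨
  c + suc n * (n C k + n C suc k)            ≡⟨ cong (λ x → c + suc n * x) (nCk+nC[k+1]≡[n+1]C[k+1] n k) ⟩
  c + suc n * c                              ∎
  where
  open ≡-Reasoning
  c c′ : ℕ
  c  = suc n C suc k
  c′ = suc n C suc (suc k)

nCk≤nC[k+1] : ∀ {n k} → 2 * suc k ≤ suc n → n C k ≤ n C suc k
nCk≤nC[k+1] {n} {k} 2[k+1]≤n+1 =
  subst (_≤ c′) (+-identityʳ c) (+-cancelˡ-≤ c _ _ (*-cancelˡ-≤ (suc k) doubled))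
  where
  c c′ : ℕ
  c  = n C k
  c′ = n C suc k
  open ≤-Reasoning
  doubled : suc k * (2 * c) ≤ suc k * (c + c′)
  doubled = begin
    suc k * (2 * c)     ≡⟨ x∙yz≈y∙xz (suc k) 2 c ⟩
    2 * (suc k * c)     ≡⟨ *-assoc 2 (suc k) c ⟨
    2 * suc k * c       ≤⟨ *-monoˡ-≤ c 2[k+1]≤n+1 ⟩
    suc n * c           ≡⟨ [k+1]*[n+1]C[k+1]≡[n+1]*nCk n k ⟨
    suc k * (suc n C suc k) ≡⟨ cong (suc k *_) (nCk+nC[k+1]≡[n+1]C[k+1] n k) ⟨
    suc k * (c + c′)    ∎

i≤h⇒nCi≤nCh : ∀ {n h i} → 2 * h ≤ suc n → i ≤ h → n C i ≤ n C h
i≤h⇒nCi≤nCh {h = zero} _ z≤n = ≤-refl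
i≤h⇒nCi≤nCh {h = suc h} 2h≤n+1 i≤h+1 with m≤n⇒m<n∨m≡n i≤h+1
... | inj₂ refl       = ≤-refl
... | inj₁ (s≤s i≤h) =
  ≤-trans (i≤h⇒nCi≤nCh (≤-trans (*-monoʳ-≤ 2 (n≤1+n h)) 2h≤n+1) i≤h) (nCk≤nC[k+1] 2h≤n+1)

nCi≤nC⌊n/2⌋ : ∀ {n h} → 2 * h ≤ n → n ≤ 2 * h + 1 → ∀ i → n C i ≤ n C h
nCi≤nC⌊n/2⌋ {n} {h} 2h≤n n≤2h+1 i with i ≤? h | i ≤? n
... | yes i≤h | _       = i≤h⇒nCi≤nCh (m≤n⇒m≤1+n 2h≤n) i≤h
... | no i≰h  | yes i≤n =
  subst (_≤ n C h) (sym (nCk≡nC[n∸k] i≤n))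
    (i≤h⇒nCi≤nCh (m≤n⇒m≤1+n 2h≤n) (m≤n+o⇒m∸n≤o n i n≤i+h))
  where
  n≤i+h : n ≤ i + h
  n≤i+h = begin
    n             ≤⟨ n≤2h+1 ⟩
    2 * h + 1     ≡⟨ +-comm (2 * h) 1 ⟩
    suc h + (h + 0) ≡⟨ cong (_+_ (suc h)) (+-identityʳ h) ⟩
    suc h + h     ≤⟨ +-monoˡ-≤ h (≰⇒> i≰h) ⟩
    i + h         ∎
    where open ≤-Reasoning
... | no _    | no i≰n  = subst (_≤ n C h) (sym (k>n⇒nCk≡0 (≰⇒> i≰n))) z≤n

nCk>0 : ∀ {n k} → k ≤ n → 0 < n C k
nCk>0 {k = zero} _ = s≤s z≤n
nCk>0 {suc n} {suc k} (s≤s k≤n) =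
  subst (0 <_) (nCk+nC[k+1]≡[n+1]C[k+1] n k) (<-≤-trans (nCk>0 k≤n) (m≤m+n (n C k) (n C suc k)))

parity-suc : ∀ n → parity (suc n) ≡ parity n ⁻¹
parity-suc zero          = refl
parity-suc (suc zero)    = refl
parity-suc (suc (suc n)) = parity-suc n

parity[2h+1]≡1ℙ : ∀ h → parity (2 * h + 1) ≡ 1ℙ
parity[2h+1]≡1ℙ h = trans (ℙ.+-homo-+ (2 * h) 1) (cong (_+ℙ 1ℙ) (ℙ.*-homo-* 2 h))

parity[n∸i]≡parity[i]⁻¹ : ∀ {n i} → parity n ≡ 1ℙ → i ≤ n → parity (n ∸ i) ≡ parity i ⁻¹
parity[n∸i]≡parity[i]⁻¹ {n} {i} odd i≤n = complement (parity i) (parity (n ∸ i)) (begin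
  parity i +ℙ parity (n ∸ i) ≡⟨ ℙ.+-homo-+ i (n ∸ i) ⟨
  parity (i + (n ∸ i))        ≡⟨ cong parity (m+[n∸m]≡n i≤n) ⟩
  parity n                    ≡⟨ odd ⟩
  1ℙ                          ∎)
  where
  open ≡-Reasoning
  complement : ∀ p q → p +ℙ q ≡ 1ℙ → q ≡ p ⁻¹
  complement 0ℙ 1ℙ _ = refl
  complement 1ℙ 0ℙ _ = refl

±1 : Parity → ℤ
±1 0ℙ = 1ℤ
±1 1ℙ = -1ℤ

-1^n≡±1[parity[n]] : ∀ n → -1ℤ ℤ.^ n ≡ ±1 (parity n)
-1^n≡±1[parity[n]] zero          = refl
-1^n≡±1[parity[n]] (suc zero)    = refl
-1^n≡±1[parity[n]] (suc (suc n)) =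
  trans (sym (ℤₚ.*-assoc -1ℤ -1ℤ (-1ℤ ℤ.^ n)))
        (trans (ℤₚ.*-identityˡ (-1ℤ ℤ.^ n)) (-1^n≡±1[parity[n]] n))

pos-∸ : ∀ {m n} → n ≤ m → + (m ∸ n) ≡ + m ℤ.- + n
pos-∸ {m} {n} n≤m = sym (trans (ℤₚ.[+m]-[+n]≡m⊖n m n) (ℤₚ.⊖-≥ n≤m))

pos-^ : ∀ m n → + (m ^ n) ≡ (+ m) ℤ.^ n
pos-^ m zero    = refl
pos-^ m (suc n) = trans (ℤₚ.pos-* m (m ^ n)) (cong (ℤ._*_ (+ m)) (pos-^ m n))

^-distribʳ-* : ∀ m n k → (m * n) ^ k ≡ m ^ k * n ^ k
^-distribʳ-* m n zero    = refl
^-distribʳ-* m n (suc k) =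
  trans (cong (m * n *_) (^-distribʳ-* m n k)) (interchange m n (m ^ k) (n ^ k))

^ᴿ≡^ : ∀ x n → x ^ᴿ n ≡ x ℤ.^ n
^ᴿ≡^ x zero    = refl
^ᴿ≡^ x (suc n) = cong (x ℤ.*_) (^ᴿ≡^ x n)

×≡pos-* : ∀ n x → n × x ≡ + n ℤ.* x
×≡pos-* zero    x = sym (ℤₚ.*-zeroˡ x)
×≡pos-* (suc n) x = trans (cong (ℤ._+_ x) (×≡pos-* n x)) (x+n*x≡[1+n]*x x (+ n))
  where
  x+n*x≡[1+n]*x : ∀ x n → x ℤ.+ n ℤ.* x ≡ (1ℤ ℤ.+ n) ℤ.* x
  x+n*x≡[1+n]*x = solve-∀

alternatingSum : ℕ → ℕ → (ℕ → ℕ) → ℤ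
alternatingSum b k d = ∑[ i ≤ k ] (±1 (parity (toℕ i) ⁻¹) ℤ.* + d (toℕ i) ℤ.* (+ b) ℤ.^ toℕ i)

[b-1]^k≡alternatingSum : ∀ b k → parity k ≡ 1ℙ → (+ b ℤ.- 1ℤ) ℤ.^ k ≡ alternatingSum b k (k C_)
[b-1]^k≡alternatingSum b k odd = begin
  (+ b ℤ.+ -1ℤ) ℤ.^ k                   ≡⟨ ^ᴿ≡^ (+ b ℤ.+ -1ℤ) k ⟨
  (+ b ℤ.+ -1ℤ) ^ᴿ k                    ≡⟨ Binomial.theorem k (+ b) -1ℤ ⟩
  Binomial.binomialExpansion (+ b) -1ℤ k ≡⟨ sum-cong-≗ (λ i → term (toℕ i) (toℕ≤pred[n] i)) ⟩
  alternatingSum b k (k C_)             ∎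
  where
  open ≡-Reasoning
  term : ∀ i → i ≤ k →
    (k C i) × ((+ b) ^ᴿ i ℤ.* -1ℤ ^ᴿ (k ∸ i)) ≡ ±1 (parity i ⁻¹) ℤ.* + (k C i) ℤ.* (+ b) ℤ.^ i
  term i i≤k = begin
    (k C i) × ((+ b) ^ᴿ i ℤ.* -1ℤ ^ᴿ (k ∸ i))     ≡⟨ ×≡pos-* (k C i) _ ⟩
    + (k C i) ℤ.* ((+ b) ^ᴿ i ℤ.* -1ℤ ^ᴿ (k ∸ i)) ≡⟨ cong (λ x → + (k C i) ℤ.* x)
                                                    (cong₂ ℤ._*_ (^ᴿ≡^ (+ b) i) (^ᴿ≡^ -1ℤ (k ∸ i))) ⟩
    + (k C i) ℤ.* ((+ b) ℤ.^ i ℤ.* -1ℤ ℤ.^ (k ∸ i)) ≡⟨ cong (λ x → + (k C i) ℤ.* ((+ b) ℤ.^ i ℤ.* x))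
                                                    (trans (-1^n≡±1[parity[n]] (k ∸ i))
                                                           (cong ±1 (parity[n∸i]≡parity[i]⁻¹ odd i≤k))) ⟩
    + (k C i) ℤ.* ((+ b) ℤ.^ i ℤ.* ±1 (parity i ⁻¹))
      ≡⟨ rearrange (+ (k C i)) ((+ b) ℤ.^ i) (±1 (parity i ⁻¹)) ⟩
    ±1 (parity i ⁻¹) ℤ.* + (k C i) ℤ.* (+ b) ℤ.^ i ∎
    where
    rearrange : ∀ c x s → c ℤ.* (x ℤ.* s) ≡ s ℤ.* c ℤ.* x
    rearrange = solve-∀

*-alternatingSum : ∀ M b k d → + M ℤ.* alternatingSum b k d ≡ alternatingSum b k (λ i → M * d i)
*-alternatingSum M b k d =
  trans (*-distribˡ-sum {suc k} (+ M) (λ i → ±1 (parity (toℕ i) ⁻¹) ℤ.* + d (toℕ i) ℤ.* (+ b) ℤ.^ toℕ i))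
        (sum-cong-≗ {suc k} (λ i → scale (±1 (parity (toℕ i) ⁻¹)) (d (toℕ i)) ((+ b) ℤ.^ toℕ i)))
  where
  scale : ∀ s c x → + M ℤ.* (s ℤ.* + c ℤ.* x) ≡ s ℤ.* + (M * c) ℤ.* x
  scale s c x = trans (reorder (+ M) s (+ c) x) (cong (λ y → s ℤ.* y ℤ.* x) (sym (ℤₚ.pos-* M c)))
    where
    reorder : ∀ m s c x → m ℤ.* (s ℤ.* c ℤ.* x) ≡ s ℤ.* (m ℤ.* c) ℤ.* x
    reorder = solve-∀

M*[b-1]^k≡alternatingSum : ∀ M b k → 1 ≤ b → parity k ≡ 1ℙ →
  + (M * (b ∸ 1) ^ k) ≡ alternatingSum b k (λ i → M * (k C i))
M*[b-1]^k≡alternatingSum M b k 1≤b odd = begin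
  + (M * (b ∸ 1) ^ k)                     ≡⟨ ℤₚ.pos-* M ((b ∸ 1) ^ k) ⟩
  + M ℤ.* + ((b ∸ 1) ^ k)                 ≡⟨ cong (ℤ._*_ (+ M)) (pos-^ (b ∸ 1) k) ⟩
  + M ℤ.* (+ (b ∸ 1)) ℤ.^ k               ≡⟨ cong (λ y → + M ℤ.* y ℤ.^ k) (pos-∸ 1≤b) ⟩
  + M ℤ.* (+ b ℤ.- 1ℤ) ℤ.^ k              ≡⟨ cong (ℤ._*_ (+ M)) ([b-1]^k≡alternatingSum b k odd) ⟩
  + M ℤ.* alternatingSum b k (k C_)       ≡⟨ *-alternatingSum M b k (k C_) ⟩
  alternatingSum b k (λ i → M * (k C i))  ∎
  where open ≡-Reasoning

applyUpTo-cong : ∀ {f g : ℕ → A} n → (∀ {i} → i < n → f i ≡ g i) → applyUpTo f n ≡ applyUpTo g n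
applyUpTo-cong zero    _   = refl
applyUpTo-cong (suc n) f≡g = cong₂ _∷_ (f≡g (s≤s z≤n)) (applyUpTo-cong n (f≡g ∘ s≤s))

applyDownFrom≡applyUpTo : ∀ (f : ℕ → A) n → applyDownFrom f n ≡ applyUpTo (λ i → f (n ∸ suc i)) n
applyDownFrom≡applyUpTo f zero    = refl
applyDownFrom≡applyUpTo f (suc n) = cong (f n ∷_) (applyDownFrom≡applyUpTo f n)

map-reverse-applyUpTo : ∀ (g : A → A) (f : ℕ → A) n → (∀ {i} → i < n → g (f (n ∸ suc i)) ≡ f i) →
  map g (reverse (applyUpTo f n)) ≡ applyUpTo f n
map-reverse-applyUpTo g f n g∘f∘reflect≡f = begin
  map g (reverse (applyUpTo f n))                ≡⟨ cong (map g) (reverse-applyUpTo f n) ⟩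
  map g (applyDownFrom f n)                      ≡⟨ cong (map g) (applyDownFrom≡applyUpTo f n) ⟩
  map g (applyUpTo (λ i → f (n ∸ suc i)) n)      ≡⟨ map-applyUpTo _ g n ⟩
  applyUpTo (λ i → g (f (n ∸ suc i))) n          ≡⟨ applyUpTo-cong n g∘f∘reflect≡f ⟩
  applyUpTo f n                                  ∎
  where open ≡-Reasoning

last-applyUpTo : ∀ (f : ℕ → A) n → last (applyUpTo f (suc n)) ≡ just (f n)
last-applyUpTo f zero    = refl
last-applyUpTo f (suc n) = last-applyUpTo (f ∘ suc) n

evalDigits-applyUpTo : ∀ b (f : ℕ → ℕ) n →
  + evalDigits b (applyUpTo f n) ≡ ∑[ i < n ] (+ f (toℕ i) ℤ.* (+ b) ℤ.^ toℕ i)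
evalDigits-applyUpTo b f zero    = refl
evalDigits-applyUpTo b f (suc n) = begin
  + (f 0 + b * evalDigits b (applyUpTo (f ∘ suc) n))
    ≡⟨ trans (ℤₚ.pos-+ (f 0) _) (cong (ℤ._+_ (+ f 0)) (ℤₚ.pos-* b _)) ⟩
  + f 0 ℤ.+ B ℤ.* + evalDigits b (applyUpTo (f ∘ suc) n)
    ≡⟨ cong₂ ℤ._+_ (sym (ℤₚ.*-identityʳ (+ f 0))) (cong (ℤ._*_ B) (evalDigits-applyUpTo b (f ∘ suc) n)) ⟩
  + f 0 ℤ.* 1ℤ ℤ.+ B ℤ.* ∑[ i < n ] term (toℕ i)
    ≡⟨ cong (ℤ._+_ (+ f 0 ℤ.* 1ℤ)) (*-distribˡ-sum {n} B (term ∘ toℕ)) ⟩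
  + f 0 ℤ.* 1ℤ ℤ.+ ∑[ i < n ] (B ℤ.* term (toℕ i))
    ≡⟨ cong (ℤ._+_ (+ f 0 ℤ.* 1ℤ)) (sum-cong-≗ {n} (λ i → shift B (+ f (suc (toℕ i))) (B ℤ.^ toℕ i))) ⟩
  ∑[ i < suc n ] (+ f (toℕ i) ℤ.* B ℤ.^ toℕ i) ∎
  where
  open ≡-Reasoning
  B : ℤ
  B = + b
  term : ℕ → ℤ
  term j = + f (suc j) ℤ.* B ℤ.^ j
  shift : ∀ x y z → x ℤ.* (y ℤ.* z) ≡ y ℤ.* (x ℤ.* z)
  shift = solve-∀

∑-cancel-pairs : ∀ n (f : ℕ → ℤ) → parity n ≡ 0ℙ →
  (∀ i → parity i ≡ 0ℙ → f i ℤ.+ f (suc i) ≡ 0ℤ) → ∑[ i < n ] f (toℕ i) ≡ 0ℤ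
∑-cancel-pairs zero          f _    _      = refl
∑-cancel-pairs (suc (suc n)) f even cancel = begin
  f 0 ℤ.+ (f 1 ℤ.+ rest) ≡⟨ ℤₚ.+-assoc (f 0) (f 1) rest ⟨
  (f 0 ℤ.+ f 1) ℤ.+ rest ≡⟨ cong₂ ℤ._+_ (cancel 0 refl)
                                        (∑-cancel-pairs n (f ∘ suc ∘ suc) even (cancel ∘ suc ∘ suc)) ⟩
  0ℤ                     ∎
  where
  open ≡-Reasoning
  rest : ℤ
  rest = ∑[ i < n ] f (suc (suc (toℕ i)))

alternatingDigit : ℕ → ℕ → Parity → ℕ
alternatingDigit b d 0ℙ = b ∸ d
alternatingDigit b d 1ℙ = d ∸ 1

borrow : ℕ → Parity → ℤ
borrow b 0ℙ = + b
borrow b 1ℙ = -1ℤ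

alternatingDigit<b : ∀ {b d} p → 1 ≤ d → d ≤ b → alternatingDigit b d p < b
alternatingDigit<b {suc b} {suc d} 0ℙ _ _ = s≤s (m∸n≤m b d)
alternatingDigit<b {d = suc d} 1ℙ _ d<b = d<b

alternatingDigit-complement : ∀ {b d} p → 1 ≤ d → d ≤ b →
  b ∸ 1 ∸ alternatingDigit b d (p ⁻¹) ≡ alternatingDigit b d p
alternatingDigit-complement {suc b} {suc d} 0ℙ _ _          = refl
alternatingDigit-complement {suc b} {suc d} 1ℙ _ (s≤s d≤b) = m∸[m∸n]≡n d≤b

alternatingDigit-value : ∀ {b d} p → 1 ≤ d → d ≤ b →
  + alternatingDigit b d p ≡ ±1 (p ⁻¹) ℤ.* + d ℤ.+ borrow b p
alternatingDigit-value {b} {d} 0ℙ _ d≤b = trans (pos-∸ d≤b) (x-y≡-1*y+x (+ b) (+ d))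
  where
  x-y≡-1*y+x : ∀ x y → x ℤ.- y ≡ -1ℤ ℤ.* y ℤ.+ x
  x-y≡-1*y+x = solve-∀
alternatingDigit-value {b} {d} 1ℙ 1≤d _ = trans (pos-∸ 1≤d) (x-1≡1*x-1 (+ d))
  where
  x-1≡1*x-1 : ∀ x → x ℤ.- 1ℤ ≡ 1ℤ ℤ.* x ℤ.+ -1ℤ
  x-1≡1*x-1 = solve-∀

∑-borrow≡0 : ∀ b n → parity n ≡ 0ℙ →
  ∑[ i < n ] (borrow b (parity (toℕ i)) ℤ.* (+ b) ℤ.^ toℕ i) ≡ 0ℤ
∑-borrow≡0 b n even = ∑-cancel-pairs n (λ i → borrow b (parity i) ℤ.* (+ b) ℤ.^ i) even pair
  where
  x+-1*x≡0 : ∀ x → x ℤ.+ -1ℤ ℤ.* x ≡ 0ℤ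
  x+-1*x≡0 = solve-∀
  pair : ∀ i → parity i ≡ 0ℙ →
    borrow b (parity i) ℤ.* (+ b) ℤ.^ i ℤ.+ borrow b (parity (suc i)) ℤ.* (+ b) ℤ.^ suc i ≡ 0ℤ
  pair i even rewrite parity-suc i | even = x+-1*x≡0 (+ b ℤ.* (+ b) ℤ.^ i)

alternatingDigits-antipalindromic : ∀ b k (d : ℕ → ℕ) {x} → parity k ≡ 1ℙ →
  (∀ {i} → i ≤ k → 1 ≤ d i) → (∀ {i} → i ≤ k → d i ≤ b) →
  (∀ {i} → i ≤ k → d (k ∸ i) ≡ d i) → 2 ≤ d k →
  + x ≡ alternatingSum b k d → Antipalindromic b x
alternatingDigits-antipalindromic b k d {x} odd d≥1 d≤b symmetric d[k]≥2 x≡sum =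
  ds , (digits<b , (d k ∸ 1 , last-ds , m<n⇒n≢0 (∸-monoˡ-≤ 1 d[k]≥2)) , value) , antipalindromic
  where
  open ≡-Reasoning
  digit : ℕ → ℕ
  digit i = alternatingDigit b (d i) (parity i)
  ds : List ℕ
  ds = applyUpTo digit (suc k)

  digits<b : All (_< b) ds
  digits<b = applyUpTo⁺₁ digit (suc k) λ {i} i<k+1 →
    alternatingDigit<b (parity i) (d≥1 (<⇒≤pred i<k+1)) (d≤b (<⇒≤pred i<k+1))

  last-ds : last ds ≡ just (d k ∸ 1)
  last-ds = trans (last-applyUpTo digit k) (cong (just ∘ alternatingDigit b (d k)) odd)

  antipalindromic : map (λ a → b ∸ 1 ∸ a) (reverse ds) ≡ ds
  antipalindromic = map-reverse-applyUpTo _ digit (suc k) λ {i} i<k+1 →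
    let i≤k = <⇒≤pred i<k+1 in begin
      b ∸ 1 ∸ alternatingDigit b (d (k ∸ i)) (parity (k ∸ i))
        ≡⟨ cong₂ (λ e p → b ∸ 1 ∸ alternatingDigit b e p)
                 (symmetric i≤k) (parity[n∸i]≡parity[i]⁻¹ odd i≤k) ⟩
      b ∸ 1 ∸ alternatingDigit b (d i) (parity i ⁻¹)
        ≡⟨ alternatingDigit-complement (parity i) (d≥1 i≤k) (d≤b i≤k) ⟩
      digit i ∎

  signedTerm borrowTerm : ℕ → ℤ
  signedTerm i = ±1 (parity i ⁻¹) ℤ.* + d i ℤ.* (+ b) ℤ.^ i
  borrowTerm i = borrow b (parity i) ℤ.* (+ b) ℤ.^ i

  split : ∀ {i} → i ≤ k → + digit i ℤ.* (+ b) ℤ.^ i ≡ signedTerm i ℤ.+ borrowTerm i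
  split {i} i≤k = trans (cong (ℤ._* (+ b) ℤ.^ i) (alternatingDigit-value (parity i) (d≥1 i≤k) (d≤b i≤k)))
                        (ℤₚ.*-distribʳ-+ ((+ b) ℤ.^ i) (±1 (parity i ⁻¹) ℤ.* + d i) (borrow b (parity i)))

  value : evalDigits b ds ≡ x
  value = ℤₚ.+-injective (begin
    + evalDigits b ds                                     ≡⟨ evalDigits-applyUpTo b digit (suc k) ⟩
    ∑[ i ≤ k ] (+ digit (toℕ i) ℤ.* (+ b) ℤ.^ toℕ i)
      ≡⟨ sum-cong-≗ (λ i → split (toℕ≤pred[n] i)) ⟩
    ∑[ i ≤ k ] (signedTerm (toℕ i) ℤ.+ borrowTerm (toℕ i))
      ≡⟨ ∑-distrib-+ {suc k} (signedTerm ∘ toℕ) (borrowTerm ∘ toℕ) ⟩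
    alternatingSum b k d ℤ.+ ∑[ i ≤ k ] borrowTerm (toℕ i)
      ≡⟨ cong (ℤ._+_ (alternatingSum b k d)) (∑-borrow≡0 b (suc k) (trans (parity-suc k) (cong _⁻¹ odd))) ⟩
    alternatingSum b k d ℤ.+ 0ℤ                           ≡⟨ ℤₚ.+-identityʳ _ ⟩
    alternatingSum b k d                                  ≡⟨ x≡sum ⟨
    + x                                                   ∎)

M*[b-1]^k-antipalindromic : ∀ M k h b → 2 ≤ M → k ≡ 2 * h + 1 → M * (k C h) ≤ b →
  Antipalindromic b (M * (b ∸ 1) ^ k)
M*[b-1]^k-antipalindromic M k h b M≥2 k≡2h+1 M*kCh≤b =
  alternatingDigits-antipalindromic b k d odd d≥1 d≤b symmetric d[k]≥2
    (M*[b-1]^k≡alternatingSum M b k (≤-trans (d≥1 z≤n) (d≤b z≤n)) odd)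
  where
  d : ℕ → ℕ
  d i = M * (k C i)
  odd : parity k ≡ 1ℙ
  odd = trans (cong parity k≡2h+1) (parity[2h+1]≡1ℙ h)
  d≥1 : ∀ {i} → i ≤ k → 1 ≤ d i
  d≥1 i≤k = *-mono-≤ (<⇒≤ M≥2) (nCk>0 i≤k)
  d≤b : ∀ {i} → i ≤ k → d i ≤ b
  d≤b {i} _ = ≤-trans (*-monoʳ-≤ M (nCi≤nC⌊n/2⌋ {k} {h} 2h≤k k≤2h+1 i)) M*kCh≤b
    where
    2h≤k : 2 * h ≤ k
    2h≤k = subst (2 * h ≤_) (sym k≡2h+1) (m≤m+n (2 * h) 1)
    k≤2h+1 : k ≤ 2 * h + 1
    k≤2h+1 = ≤-reflexive k≡2h+1
  symmetric : ∀ {i} → i ≤ k → d (k ∸ i) ≡ d i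
  symmetric i≤k = cong (M *_) (sym (nCk≡nC[n∸k] i≤k))
  d[k]≥2 : 2 ≤ d k
  d[k]≥2 = subst (2 ≤_) (sym (trans (cong (M *_) (nCn≡1 k)) (*-identityʳ M))) M≥2

mainTheorem12 : (m k h b : ℕ) → 1 < m → 1 < k → k ≡ 2 * h + 1 →
    (k C h) * m ^ k ≤ b → Antipalindromic b ((m * (b ∸ 1)) ^ k)
mainTheorem12 m k h b 1<m 1<k k≡2h+1 kCh*m^k≤b =
  subst (Antipalindromic b) (sym (^-distribʳ-* m (b ∸ 1) k))
    (M*[b-1]^k-antipalindromic (m ^ k) k h b m^k≥2 k≡2h+1 m^k*kCh≤b)
  where
  m^k≥2 : 2 ≤ m ^ k
  m^k≥2 = ≤-trans 1<m (subst (_≤ m ^ k) (*-identityʳ m)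
                              (^-monoʳ-≤ m {{>-nonZero (m<n⇒0<n 1<m)}} (<⇒≤ 1<k)))
  m^k*kCh≤b : m ^ k * (k C h) ≤ b
  m^k*kCh≤b = subst (_≤ b) (*-comm (k C h) (m ^ k)) kCh*m^k≤b
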